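{- $\boldsymbol\ell=\varphi(\boldsymbol m)$, where $\boldsymbol\ell$ and $\boldsymbol m$ are the lexicographically least and greatest faux-bonacci $\omega$-words.
   Context: $\varphi$ is the morphism $0\mapsto01$, $1\mapsto0$. For non-empty $X$, $X^-$ is $X$ with last letter erased; a $4^-$-power is $XXXX^-$ with $X$ non-empty; a binary word is faux-bonacci (fb) if it has no factor $11$ and no factor that is a $4^-$-power. Lexicographic order uses $0<1$. $\boldsymbol\ell=\lim_n\ell_n$ and $\boldsymbol m=\lim_n m_n$, where $\ell_n$ (resp. $m_n$) is the lexicographically least (resp. greatest) length-$n$ word that is a prefix of some fb $\omega$-word; $\boldsymbol\ell$ (resp. $\boldsymbol m$) is the lexicographically least (resp. greatest) fb $\omega$-word. -}

module Defs where

open import Data.Bool using (Bool; true; false)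
open import Data.Nat using (ℕ; zero; suc)
open import Data.List using (List; []; _∷_; _++_; _∷ʳ_; length; concatMap)
open import Data.Product using (Σ; ∃; _×_; _,_)
open import Data.Sum using (_⊎_)
open import Relation.Nullary using (¬_)
open import Relation.Binary.PropositionalEquality using (_≡_)

-- Letters: 0 is false, 1 is true (so 0 < 1 matches false < true).
Letter : Set
Letter = Bool

Word : Set
Word = List Letter

ωWord : Set
ωWord = ℕ → Letter

pref : ωWord → ℕ → Word
pref x zero    = []
pref x (suc n) = x 0 ∷ pref (λ i → x (suc i)) n

Factor : Word → Word → Set
Factor u w = Σ Word λ p → Σ Word λ s → w ≡ p ++ u ++ s

-- u is a 4⁻-power: u = X X X X⁻ with X non-empty; writing X = Y a, X⁻ = Y
FourMinusPower : Word → Set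
FourMinusPower u = Σ Word λ Y → Σ Letter λ a →
  u ≡ (Y ∷ʳ a) ++ (Y ∷ʳ a) ++ (Y ∷ʳ a) ++ Y

FB : Word → Set
FB w = ¬ Factor (true ∷ true ∷ []) w × (∀ u → Factor u w → ¬ FourMinusPower u)

-- an ω-word is fb iff all its (finite) factors are fb, i.e. all its prefixes are fb
FBω : ωWord → Set
FBω x = ∀ n → FB (pref x n)

_≈ω_ : ωWord → ωWord → Set
x ≈ω y = ∀ i → x i ≡ y i

_<lex_ : ωWord → ωWord → Set
x <lex y = Σ ℕ λ n → pref x n ≡ pref y n × x n ≡ false × y n ≡ true

_≤lex_ : ωWord → ωWord → Set
x ≤lex y = x ≈ω y ⊎ x <lex y

IsLeastFB : ωWord → Set
IsLeastFB x = FBω x × (∀ y → FBω y → x ≤lex y)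

IsGreatestFB : ωWord → Set
IsGreatestFB x = FBω x × (∀ y → FBω y → y ≤lex x)

φ₁ : Letter → Word
φ₁ false = false ∷ true ∷ []
φ₁ true  = false ∷ []

φ : Word → Word
φ = concatMap φ₁

-- φ extended to ω-words: y = φ(x) iff φ(every prefix of x) is a prefix of y
-- (since φ is non-erasing, these prefixes determine φ(x) completely)
IsφImage : ωWord → ωWord → Set
IsφImage y x = ∀ n → pref y (length (φ (pref x n))) ≡ φ (pref x n)

{-# OPTIONS --safe #-}
-- φ reverses the lexicographic order of ω-words, and an ω-word x is faux-bonacci exactly when φ(x) is:
-- a 4⁻-power in φ(x) either starts at the image of a letter or one position later, and can then be
-- pulled back to a 4⁻-power of x, because φ is injective on prefixes and, in the absence of 11 in x,
-- the images of two consecutive letters have total length at least 3. Hence φ(m) is fb, so l ≤ φ(m);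
-- thus l starts with 0 and has no factor 11, i.e. l = φ(y) for some y, which is again fb. Now y ≤ m,
-- and y < m would give φ(m) < φ(y) = l; so y = m and l = φ(m).
module Submission where

open import Defs
open import Data.Bool using (true; false; not; if_then_else_)
open import Data.Bool.Properties using (not-injective; ¬-not)
open import Data.Nat
open import Data.Nat.Properties
open import Data.List using ([]; _∷_; _++_; _∷ʳ_; length)
open import Data.List.Properties
  using (length-++; ++-assoc; ++-identityʳ; ++-cancelˡ; ∷-injective; ∷-injectiveˡ; ∷-injectiveʳ)
open import Data.Product
open import Function using (_∘_)
open import Data.Sum
open import Data.Empty
open import Relation.Nullary
open import Relation.Binary.Definitions using (tri<; tri≈; tri>)
open import Relation.Binary.PropositionalEquality

true≢false : true ≢ false
true≢false ()

drop : ℕ → ωWord → ωWord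
drop n x i = x (n + i)

tail : ωWord → ωWord
tail = drop 1

Agree : ℕ → ωWord → ωWord → Set
Agree n x y = ∀ i → i < n → x i ≡ y i

≈ω⇒Agree : ∀ {n x y} → x ≈ω y → Agree n x y
≈ω⇒Agree x≈y i _ = x≈y i

Agree-resp : ∀ {n x x′ y y′} → x ≈ω x′ → y ≈ω y′ → Agree n x y → Agree n x′ y′
Agree-resp x≈x′ y≈y′ agree i i<n = trans (sym (x≈x′ i)) (trans (agree i i<n) (y≈y′ i))

Agree-sym : ∀ {n x y} → Agree n x y → Agree n y x
Agree-sym agree i i<n = sym (agree i i<n)

Agree-mono : ∀ {m n x y} → m ≤ n → Agree n x y → Agree m x y
Agree-mono m≤n agree i i<m = agree i (<-≤-trans i<m m≤n)

Agree-drop : ∀ m {n x y} → Agree (m + n) x y → Agree n (drop m x) (drop m y)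
Agree-drop m agree i i<n = agree (m + i) (+-monoʳ-< m i<n)

Agree-++ : ∀ m {n x y} → Agree m x y → Agree n (drop m x) (drop m y) → Agree (m + n) x y
Agree-++ m front back i i<m+n with i <? m
... | yes i<m = front i i<m
... | no  i≮m with m≤n⇒∃[o]m+o≡n (≮⇒≥ i≮m)
...   | j , refl = back j (+-cancelˡ-< m j _ i<m+n)

drop-cong : ∀ n {x y} → x ≈ω y → drop n x ≈ω drop n y
drop-cong n x≈y i = x≈y (n + i)

drop-drop : ∀ m n x → drop m (drop n x) ≈ω drop (n + m) x
drop-drop m n x i = cong x (sym (+-assoc n m i))

pref-cong : ∀ n {x y} → Agree n x y → pref x n ≡ pref y n
pref-cong zero    agree = refl
pref-cong (suc n) agree = cong₂ _∷_ (agree 0 z<s) (pref-cong n (Agree-drop 1 agree))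

pref-agree : ∀ n {x y} → pref x n ≡ pref y n → Agree n x y
pref-agree (suc n) eq zero    _         = ∷-injectiveˡ eq
pref-agree (suc n) eq (suc i) (s≤s i<n) = pref-agree n (∷-injectiveʳ eq) i i<n

pref-+ : ∀ m n x → pref x (m + n) ≡ pref x m ++ pref (drop m x) n
pref-+ zero    n x = refl
pref-+ (suc m) n x = cong (x 0 ∷_) (pref-+ m n (tail x))

pref-suc : ∀ n x → pref x (suc n) ≡ pref x n ∷ʳ x n
pref-suc zero    x = refl
pref-suc (suc n) x = cong (x 0 ∷_) (pref-suc n (tail x))

pref-prefix : ∀ n x u s → pref x n ≡ u ++ s → pref x (length u) ≡ u
pref-prefix n       x []      s eq = refl
pref-prefix zero    x (a ∷ u) s ()
pref-prefix (suc n) x (a ∷ u) s eq =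
  cong₂ _∷_ (∷-injectiveˡ eq) (pref-prefix n (tail x) u s (∷-injectiveʳ eq))

pref-factor : ∀ n x p u s → pref x n ≡ p ++ u ++ s → pref (drop (length p) x) (length u) ≡ u
pref-factor n       x []      u s eq = pref-prefix n x u s eq
pref-factor zero    x (a ∷ p) u s ()
pref-factor (suc n) x (a ∷ p) u s eq = pref-factor n (tail x) p u s (∷-injectiveʳ eq)

ElevenPrefix : ωWord → Set
ElevenPrefix x = x 0 ≡ true × x 1 ≡ true

-- x starts with X X X X⁻ for some X of length suc k.
FourMinusPowerPrefix : ℕ → ωWord → Set
FourMinusPowerPrefix k x = Agree (suc k + (suc k + k)) x (drop (suc k) x)

ForbiddenPrefix : ωWord → Set
ForbiddenPrefix x = ElevenPrefix x ⊎ ∃ λ k → FourMinusPowerPrefix k x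

HasForbidden : ωWord → Set
HasForbidden x = ∃ λ i → ForbiddenPrefix (drop i x)

No11 : ωWord → Set
No11 x = ∀ i → x i ≡ true → x (suc i) ≡ false

FourMinusPowerPrefix-resp : ∀ {k x y} → x ≈ω y → FourMinusPowerPrefix k x → FourMinusPowerPrefix k y
FourMinusPowerPrefix-resp {k} x≈y = Agree-resp x≈y (drop-cong (suc k) x≈y)

ForbiddenPrefix-resp : ∀ {x y} → x ≈ω y → ForbiddenPrefix x → ForbiddenPrefix y
ForbiddenPrefix-resp x≈y (inj₁ (x0 , x1)) = inj₁ (trans (sym (x≈y 0)) x0 , trans (sym (x≈y 1)) x1)
ForbiddenPrefix-resp x≈y (inj₂ (k , per)) = inj₂ (k , FourMinusPowerPrefix-resp x≈y per)

HasForbidden-drop : ∀ n {x} → HasForbidden (drop n x) → HasForbidden x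
HasForbidden-drop n {x} (i , forbidden) = n + i , ForbiddenPrefix-resp (drop-drop i n x) forbidden

¬HasForbidden⇒No11 : ∀ {x} → ¬ HasForbidden x → No11 x
¬HasForbidden⇒No11 {x} nf i xi = ¬-not λ xsi →
  nf (i , inj₁ (trans (cong x (+-identityʳ i)) xi , trans (cong x (+-comm i 1)) xsi))

No11⇒¬ElevenPrefix : ∀ {x} → No11 x → ∀ i → ¬ ElevenPrefix (drop i x)
No11⇒¬ElevenPrefix {x} no11 i (x0 , x1) =
  true≢false (trans (sym x1) (trans (cong x (+-suc i 0)) (no11 (i + 0) x0)))

periodic-pref : ∀ p n x → Agree n x (drop p x) → pref x (p + n) ≡ pref x p ++ pref x n
periodic-pref p n x per = trans (pref-+ p n x) (cong (pref x p ++_) (sym (pref-cong n per)))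

FourMinusPowerPrefix⇒FourMinusPower : ∀ k x → FourMinusPowerPrefix k x →
  FourMinusPower (pref x (suc k + (suc k + (suc k + k))))
FourMinusPowerPrefix⇒FourMinusPower k x per = pref x k , x k , (begin
  pref x (K + (K + (K + k)))  ≡⟨ periodic-pref K _ x per ⟩
  X ++ pref x (K + (K + k))   ≡⟨ cong (X ++_) (periodic-pref K _ x (Agree-mono (m≤n+m _ K) per)) ⟩
  X ++ X ++ pref x (K + k)    ≡⟨ cong (λ w → X ++ X ++ w) (periodic-pref K k x (Agree-mono k≤ per)) ⟩
  X ++ X ++ X ++ pref x k     ≡⟨ cong (λ V → V ++ V ++ V ++ pref x k) (pref-suc k x) ⟩
  (pref x k ∷ʳ x k) ++ (pref x k ∷ʳ x k) ++ (pref x k ∷ʳ x k) ++ pref x k ∎)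
  where
  open ≡-Reasoning
  K = suc k
  X = pref x K
  k≤ : k ≤ K + (K + k)
  k≤ = ≤-trans (m≤n+m k K) (m≤n+m (K + k) K)

pref-FourMinusPower⇒FourMinusPowerPrefix : ∀ y u → pref y (length u) ≡ u → FourMinusPower u →
  ∃ λ k → FourMinusPowerPrefix k y
pref-FourMinusPower⇒FourMinusPowerPrefix y u pu (Y , a , refl) =
  length Y , subst₂ (λ n p → Agree n y (drop p y)) length-W length-V (pref-agree (length W) W-period)
  where
  V = Y ∷ʳ a
  W = V ++ V ++ Y
  length-V : length V ≡ suc (length Y)
  length-V = trans (length-++ Y) (+-comm (length Y) 1)
  length-W : length W ≡ suc (length Y) + (suc (length Y) + length Y)
  length-W = trans (length-++ V) (cong₂ _+_ length-V (trans (length-++ V) (cong (_+ length Y) length-V)))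
  pref-V : pref y (length V) ≡ V
  pref-V = pref-prefix _ y V W pu
  shifted-W : pref (drop (length V) y) (length W) ≡ W
  shifted-W = ++-cancelˡ V _ _ (begin
    V ++ pref (drop (length V) y) (length W)           ≡⟨ cong (_++ pref (drop (length V) y) (length W)) pref-V ⟨
    pref y (length V) ++ pref (drop (length V) y) (length W) ≡⟨ pref-+ (length V) (length W) y ⟨
    pref y (length V + length W)                       ≡⟨ cong (pref y) (length-++ V) ⟨
    pref y (length (V ++ W))                           ≡⟨ pu ⟩
    V ++ W                                             ∎)
    where open ≡-Reasoning
  V++W≡W++aY : V ++ W ≡ W ++ (a ∷ Y)
  V++W≡W++aY = trans (cong (λ w → V ++ V ++ w) (++-assoc Y (a ∷ []) Y))
    (sym (trans (++-assoc V (V ++ Y) (a ∷ Y)) (cong (V ++_) (++-assoc V Y (a ∷ Y)))))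
  W-period : pref y (length W) ≡ pref (drop (length V) y) (length W)
  W-period = trans (pref-prefix _ y W (a ∷ Y) (trans pu V++W≡W++aY)) (sym shifted-W)

pref-drop-factor : ∀ i n x → Factor (pref (drop i x) n) (pref x (i + n))
pref-drop-factor i n x = pref x i , [] , trans (pref-+ i n x) (cong (pref x i ++_) (sym (++-identityʳ _)))

HasForbidden⇒¬FBω : ∀ x → HasForbidden x → ¬ FBω x
HasForbidden⇒¬FBω x (i , inj₁ (x0 , x1)) fb = proj₁ (fb (i + 2))
  (subst (λ u → Factor u (pref x (i + 2))) (cong₂ (λ a b → a ∷ b ∷ []) x0 x1) (pref-drop-factor i 2 x))
HasForbidden⇒¬FBω x (i , inj₂ (k , per)) fb = proj₂ (fb (i + (suc k + (suc k + (suc k + k))))) _ (pref-drop-factor i _ x)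
  (FourMinusPowerPrefix⇒FourMinusPower k (drop i x) per)

¬HasForbidden⇒FBω : ∀ x → ¬ HasForbidden x → FBω x
¬HasForbidden⇒FBω x nf n = no-11 , no-4⁻
  where
  no-11 : ¬ Factor (true ∷ true ∷ []) (pref x n)
  no-11 (p , s , eq) with ∷-injective (pref-factor n x p _ s eq)
  ... | x0 , x1 = nf (length p , inj₁ (x0 , ∷-injectiveˡ x1))
  no-4⁻ : ∀ u → Factor u (pref x n) → ¬ FourMinusPower u
  no-4⁻ u (p , s , eq) power = nf (length p , inj₂
    (pref-FourMinusPower⇒FourMinusPowerPrefix (drop (length p) x) u (pref-factor n x p u s eq) power))

-- The length of φ₁ b, written so that it is visibly a successor.
blockLength : Letter → ℕ
blockLength b = suc (if b then 0 else 1)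

mutual
  φω : ωWord → ωWord
  φω z zero    = false
  φω z (suc i) = φω-after (z 0) (tail z) i

  -- φω of the word b t, with its leading 0 removed
  φω-after : Letter → ωWord → ωWord
  φω-after true  t i       = φω t i
  φω-after false t zero    = true
  φω-after false t (suc i) = φω t i

-- φlen z n is the length of φ (pref z n), the position where φω z starts the image of z n.
φlen : ωWord → ℕ → ℕ
φlen z zero    = 0
φlen z (suc n) = blockLength (z 0) + φlen (tail z) n

length-φ₁ : ∀ b → length (φ₁ b) ≡ blockLength b
length-φ₁ true  = refl
length-φ₁ false = refl

blockLength≤2 : ∀ b → blockLength b ≤ 2
blockLength≤2 true  = s≤s z≤n
blockLength≤2 false = ≤-refl

φω-after-skip : ∀ b t i → φω-after b t (pred (blockLength b) + i) ≡ φω t i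
φω-after-skip true  t i = refl
φω-after-skip false t i = refl

φω-step : ∀ z i → φω z (blockLength (z 0) + i) ≡ φω (tail z) i
φω-step z = φω-after-skip (z 0) (tail z)

φω-block : ∀ n z i → φω z (φlen z n + i) ≡ φω (drop n z) i
φω-block zero    z i = refl
φω-block (suc n) z i = begin
  φω z (blockLength (z 0) + φlen (tail z) n + i)   ≡⟨ cong (φω z) (+-assoc (blockLength (z 0)) _ i) ⟩
  φω z (blockLength (z 0) + (φlen (tail z) n + i)) ≡⟨ φω-step z _ ⟩
  φω (tail z) (φlen (tail z) n + i)                ≡⟨ φω-block n (tail z) i ⟩
  φω (drop (suc n) z) i                            ∎
  where open ≡-Reasoning

φω-drop : ∀ n z {p} → φlen z n ≡ p → φω (drop n z) ≈ω drop p (φω z)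
φω-drop n z refl i = sym (φω-block n z i)

φω-1 : ∀ z → φω z 1 ≡ not (z 0)
φω-1 z = after-0 (z 0) (tail z)
  where
  after-0 : ∀ b t → φω-after b t 0 ≡ not b
  after-0 true  t = refl
  after-0 false t = refl

φω-block-second : ∀ n z → φω z (suc (φlen z n)) ≡ not (z n)
φω-block-second n z = begin
  φω z (suc (φlen z n))  ≡⟨ cong (φω z) (+-comm 1 (φlen z n)) ⟩
  φω z (φlen z n + 1)    ≡⟨ φω-block n z 1 ⟩
  φω (drop n z) 1        ≡⟨ φω-1 (drop n z) ⟩
  not (z (n + 0))        ≡⟨ cong (not ∘ z) (+-identityʳ n) ⟩
  not (z n)              ∎
  where open ≡-Reasoning

mutual
  φω-No11 : ∀ z → No11 (φω z)
  φω-No11 z zero    ()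
  φω-No11 z (suc i) h = φω-after-No11 (z 0) (tail z) i h

  φω-after-No11 : ∀ b t i → φω-after b t i ≡ true → φω-after b t (suc i) ≡ false
  φω-after-No11 true  t i       h = φω-No11 t i h
  φω-after-No11 false t zero    h = refl
  φω-after-No11 false t (suc i) h = φω-No11 t i h

φlen-cong : ∀ n {z z′} → Agree n z z′ → φlen z n ≡ φlen z′ n
φlen-cong zero    agree = refl
φlen-cong (suc n) agree =
  cong₂ (λ b m → blockLength b + m) (agree 0 z<s) (φlen-cong n (Agree-drop 1 agree))

φlen-+ : ∀ m n z → φlen z (m + n) ≡ φlen z m + φlen (drop m z) n
φlen-+ zero    n z = refl
φlen-+ (suc m) n z =
  trans (cong (blockLength (z 0) +_) (φlen-+ m n (tail z))) (sym (+-assoc (blockLength (z 0)) _ _))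

φlen-suc : ∀ n z → φlen z (suc n) ≡ φlen z n + blockLength (z n)
φlen-suc n z = begin
  φlen z (suc n)                        ≡⟨ cong (φlen z) (+-comm 1 n) ⟩
  φlen z (n + 1)                        ≡⟨ φlen-+ n 1 z ⟩
  φlen z n + (blockLength (z (n + 0)) + 0) ≡⟨ cong (φlen z n +_) (+-identityʳ _) ⟩
  φlen z n + blockLength (z (n + 0))    ≡⟨ cong (λ i → φlen z n + blockLength (z i)) (+-identityʳ n) ⟩
  φlen z n + blockLength (z n)          ∎
  where open ≡-Reasoning

φlen-mono : ∀ z {m n} → m ≤ n → φlen z m ≤ φlen z n
φlen-mono z {m} m≤n with m≤n⇒∃[o]m+o≡n m≤n
... | o , refl = subst (φlen z m ≤_) (sym (φlen-+ m o z)) (m≤m+n _ _)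

φlen-< : ∀ z {m n} → m < n → φlen z m < φlen z n
φlen-< z {m} m<n = <-≤-trans φlen-<-suc (φlen-mono z m<n)
  where
  φlen-<-suc : φlen z m < φlen z (suc m)
  φlen-<-suc = subst (φlen z m <_) (sym (φlen-suc m z)) (m<m+n _ z<s)

n≤φlen : ∀ n z → n ≤ φlen z n
n≤φlen zero    z = z≤n
n≤φlen (suc n) z = s≤s (≤-trans (n≤φlen n (tail z)) (m≤n+m _ _))

φω-agree : ∀ n {z z′} → Agree n z z′ → Agree (suc (φlen z n)) (φω z) (φω z′)
φω-agree zero    agree zero    _         = refl
φω-agree zero    agree (suc i) (s≤s ())
φω-agree (suc n) agree zero    _ = refl
φω-agree (suc n) {z} {z′} agree (suc i) (s≤s i<) =
  trans (after-agree (z 0) i i<) (cong (λ b → φω-after b (tail z′) i) (agree 0 z<s))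
  where
  tail-agree : Agree (suc (φlen (tail z) n)) (φω (tail z)) (φω (tail z′))
  tail-agree = φω-agree n (Agree-drop 1 agree)
  after-agree : ∀ b j → j < blockLength b + φlen (tail z) n →
                φω-after b (tail z) j ≡ φω-after b (tail z′) j
  after-agree true  j       j<      = tail-agree j j<
  after-agree false zero    _       = refl
  after-agree false (suc j) (s≤s j<) = tail-agree j j<

φω-cong : ∀ {z z′} → z ≈ω z′ → φω z ≈ω φω z′
φω-cong {z} z≈z′ i = φω-agree (suc i) (≈ω⇒Agree z≈z′) i (s≤s (≤-trans (n≤1+n i) (n≤φlen (suc i) z)))

φω-cancel : ∀ j {z z′} → Agree (suc (suc (φlen z j))) (φω z) (φω z′) → z j ≡ z′ j
φω-cancel zero {z} {z′} agree =
  not-injective (trans (sym (φω-1 z)) (trans (agree 1 (s≤s (s≤s z≤n))) (φω-1 z′)))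
φω-cancel (suc j) {z} {z′} agree = φω-cancel j tail-agree
  where
  B = blockLength (z 0)
  L = φlen (tail z) j
  head-eq : z 0 ≡ z′ 0
  head-eq = φω-cancel zero (Agree-mono (s≤s (s≤s z≤n)) agree)
  shift : ∀ {i} → i < suc (suc L) → B + i < suc (suc (B + L))
  shift {i} i< = subst (B + i <_) (trans (+-suc B (suc L)) (cong suc (+-suc B L))) (+-monoʳ-< B i<)
  tail-agree : Agree (suc (suc L)) (φω (tail z)) (φω (tail z′))
  tail-agree i i< = begin
    φω (tail z) i                    ≡⟨ φω-step z i ⟨
    φω z (B + i)                     ≡⟨ agree (B + i) (shift i<) ⟩
    φω z′ (B + i)                    ≡⟨ cong (λ b → φω z′ (blockLength b + i)) head-eq ⟩
    φω z′ (blockLength (z′ 0) + i)   ≡⟨ φω-step z′ i ⟩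
    φω (tail z′) i                   ∎
    where open ≡-Reasoning

φω-cancel-prefix : ∀ N n {z z′} → (∀ j → j < n → suc (suc (φlen z j)) ≤ N) →
                   Agree N (φω z) (φω z′) → Agree n z z′
φω-cancel-prefix N n bound agree j j<n = φω-cancel j (Agree-mono (bound j j<n) agree)

BlockPosition : ωWord → ℕ → Set
BlockPosition z p = (∃ λ n → p ≡ φlen z n) ⊎ (∃ λ n → p ≡ suc (φlen z n) × z n ≡ false)

BlockPosition-tail : ∀ z {p} → BlockPosition (tail z) p → BlockPosition z (blockLength (z 0) + p)
BlockPosition-tail z (inj₁ (n , refl))      = inj₁ (suc n , refl)
BlockPosition-tail z (inj₂ (n , refl , zn)) = inj₂ (suc n , +-suc (blockLength (z 0)) _ , zn)

block-position : ∀ p z → BlockPosition z p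
block-position zero          z = inj₁ (0 , refl)
block-position (suc p)       z with z 0 in e
block-position (suc p)       z | true  =
  subst (λ b → BlockPosition z (blockLength b + p)) e (BlockPosition-tail z (block-position p (tail z)))
block-position (suc zero)    z | false = inj₂ (0 , refl , e)
block-position (suc (suc p)) z | false =
  subst (λ b → BlockPosition z (blockLength b + p)) e (BlockPosition-tail z (block-position p (tail z)))

φω-false⇒block-start : ∀ p z → φω z p ≡ false → ∃ λ n → p ≡ φlen z n
φω-false⇒block-start p z φzp with block-position p z
... | inj₁ start           = start
... | inj₂ (n , refl , zn) =
  ⊥-elim (true≢false (trans (sym (trans (φω-block-second n z) (cong not zn))) φzp))

φω-2 : ∀ z → z 0 ≡ true → φω z 2 ≡ not (z 1)
φω-2 z z0 = trans (cong (λ b → φω z (blockLength b + 1)) (sym z0)) (trans (φω-step z 1) (φω-1 (tail z)))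

blockLength-No11 : ∀ a b → (a ≡ true → b ≡ false) → 3 ≤ blockLength a + blockLength b
blockLength-No11 true  true  no11 = contradiction (no11 refl) λ ()
blockLength-No11 true  false no11 = ≤-refl
blockLength-No11 false b     no11 = s≤s (s≤s (s≤s z≤n))

φlen-No11 : ∀ {z} → No11 z → ∀ j → 3 + φlen z j ≤ φlen z (2 + j)
φlen-No11 {z} no11 j = begin
  3 + L                                             ≡⟨ +-comm 3 L ⟩
  L + 3                                             ≤⟨ +-monoʳ-≤ L (blockLength-No11 (z j) (z (suc j)) (no11 j)) ⟩
  L + (blockLength (z j) + blockLength (z (suc j))) ≡⟨ +-assoc L _ _ ⟨
  L + blockLength (z j) + blockLength (z (suc j))   ≡⟨ cong (_+ blockLength (z (suc j))) (φlen-suc j z) ⟨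
  φlen z (suc j) + blockLength (z (suc j))          ≡⟨ φlen-suc (suc j) z ⟨
  φlen z (2 + j)                                    ∎
  where
  open ≤-Reasoning
  L = φlen z j

φω-ForbiddenPrefix : ∀ {z} → ForbiddenPrefix z → ForbiddenPrefix (φω z)
φω-ForbiddenPrefix {z} (inj₁ (z0 , z1)) = inj₂ (0 , period-one)
  where
  φz1 : φω z 1 ≡ false
  φz1 = trans (φω-1 z) (cong not z0)
  φz2 : φω z 2 ≡ false
  φz2 = trans (φω-2 z z0) (cong not z1)
  period-one : FourMinusPowerPrefix 0 (φω z)
  period-one zero          _ = sym φz1
  period-one (suc zero)    _ = trans φz1 (sym φz2)
  period-one (suc (suc i)) (s≤s (s≤s ()))
φω-ForbiddenPrefix {z} (inj₂ (k , per)) =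
  inj₂ (pred P , Agree-mono bound (Agree-resp (λ _ → refl) (φω-drop K z refl) (φω-agree (K + (K + k)) per)))
  where
  K = suc k
  P = φlen z K
  L = φlen z k
  φlen-period : φlen z (K + (K + k)) ≡ P + (P + L)
  φlen-period = begin
    φlen z (K + (K + k))        ≡⟨ φlen-+ K (K + k) z ⟩
    P + φlen (drop K z) (K + k) ≡⟨ cong (P +_) (φlen-cong (K + k) (Agree-mono (m≤n+m _ K) per)) ⟨
    P + φlen z (K + k)          ≡⟨ cong (P +_) (φlen-+ K k z) ⟩
    P + (P + φlen (drop K z) k) ≡⟨ cong (λ m → P + (P + m)) (φlen-cong k (Agree-mono k≤ per)) ⟨
    P + (P + L)                 ∎
    where
    open ≡-Reasoning
    k≤ : k ≤ K + (K + k)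
    k≤ = ≤-trans (m≤n+m k K) (m≤n+m (K + k) K)
  P≤L+2 : P ≤ 2 + L
  P≤L+2 = subst (P ≤_) (+-comm L 2)
    (subst (_≤ L + 2) (sym (φlen-suc k z)) (+-monoʳ-≤ L (blockLength≤2 (z k))))
  bound : P + (P + pred P) ≤ suc (φlen z (K + (K + k)))
  bound = begin
    P + (P + pred P)     ≤⟨ +-monoʳ-≤ P (+-monoʳ-≤ P (≤-pred P≤L+2)) ⟩
    P + (P + suc L)      ≡⟨ cong (P +_) (+-suc P L) ⟩
    P + suc (P + L)      ≡⟨ +-suc P (P + L) ⟩
    suc (P + (P + L))    ≡⟨ cong suc φlen-period ⟨
    suc (φlen z (K + (K + k))) ∎
    where open ≤-Reasoning

φω-HasForbidden : ∀ {z} → HasForbidden z → HasForbidden (φω z)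
φω-HasForbidden {z} (i , forbidden) =
  φlen z i , ForbiddenPrefix-resp (φω-drop i z refl) (φω-ForbiddenPrefix forbidden)

FourMinusPowerPrefix-untail : ∀ {k u} → u 0 ≡ false → u 1 ≡ true → No11 u →
                              FourMinusPowerPrefix k (tail u) → FourMinusPowerPrefix k u
FourMinusPowerPrefix-untail {k} {u} u0 u1 no11 per zero _ = trans u0 (sym uK≡false)
  where
  -- u (suc k + 1) = u 1 = true forces u (suc k) = false, as there is no 11.
  uK≡false : u (suc (k + 0)) ≡ false
  uK≡false = ¬-not λ uK → true≢false (trans (sym (trans (sym (per 0 z<s)) u1)) (no11 _ uK))
FourMinusPowerPrefix-untail {k} {u} u0 u1 no11 per (suc j) j< =
  trans (per j (≤-trans (n≤1+n _) j<)) (cong u (sym (+-suc (suc k) j)))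

-- z is compared with its shift by c, one block of c letters at a time; the images of the first two blocks
-- end well inside the period of φω z, and the last block has c - 1 letters, whose image is short
-- enough only because consecutive letters of z have images of total length at least 3.
φω-period-desubst : ∀ {z} → No11 z → ∀ m k → suc (suc k) ≡ φlen z (suc m) →
                    FourMinusPowerPrefix (suc k) (φω z) → FourMinusPowerPrefix m z
φω-period-desubst {z} no11 m k P≡ per = Agree-++ c z≈z₁ (Agree-++ c z₁≈z₂ z₂≈z₃)
  where
  c = suc m
  P = suc (suc k)
  z₁ = drop c z
  z₂ = drop c z₁
  z₃ = drop c z₂
  φz₁ : φω z₁ ≈ω drop P (φω z)
  φz₁ = φω-drop c z (sym P≡)
  short-blocks : ∀ j → j < c → suc (suc (φlen z j)) ≤ suc P
  short-blocks j j<c = s≤s (subst (φlen z j <_) (sym P≡) (φlen-< z j<c))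
  suc-P≤ : ∀ n → suc P ≤ P + suc n
  suc-P≤ n = subst (_≤ P + suc n) (+-comm P 1) (+-monoʳ-≤ P (s≤s z≤n))
  z≈z₁ : Agree c z z₁
  z≈z₁ = φω-cancel-prefix _ c (λ j j<c → ≤-trans (short-blocks j j<c) (suc-P≤ _))
           (Agree-resp (λ _ → refl) (λ i → sym (φz₁ i)) per)
  φlen-z₁ : ∀ j → j ≤ c → φlen z₁ j ≡ φlen z j
  φlen-z₁ j j≤c = φlen-cong j (Agree-mono j≤c (Agree-sym z≈z₁))
  φz₂ : φω z₂ ≈ω drop P (drop P (φω z))
  φz₂ i = trans (φω-drop c z₁ (trans (φlen-z₁ c ≤-refl) (sym P≡)) i) (φz₁ (P + i))
  z₁≈z₂ : Agree c z₁ z₂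
  z₁≈z₂ = φω-cancel-prefix _ c
    (λ j j<c → subst (λ l → suc (suc l) ≤ P + suc k) (sym (φlen-z₁ j (<⇒≤ j<c)))
                 (≤-trans (short-blocks j j<c) (suc-P≤ k)))
    (Agree-resp (λ i → sym (φz₁ i)) (λ i → sym (φz₂ i)) (Agree-drop P per))
  φlen-z₂ : ∀ j → j ≤ c → φlen z₂ j ≡ φlen z j
  φlen-z₂ j j≤c = trans (φlen-cong j (Agree-mono j≤c (Agree-sym z₁≈z₂))) (φlen-z₁ j j≤c)
  φz₃ : φω z₃ ≈ω drop P (drop P (drop P (φω z)))
  φz₃ i = trans (φω-drop c z₂ (trans (φlen-z₂ c ≤-refl) (sym P≡)) i) (φz₂ (P + i))
  gap : ∀ j → j < m → suc (suc (φlen z₂ j)) ≤ suc k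
  gap j j<m = ≤-pred (begin
    3 + φlen z₂ j   ≡⟨ cong (3 +_) (φlen-z₂ j (≤-trans (n≤1+n j) (s≤s (<⇒≤ j<m)))) ⟩
    3 + φlen z j    ≤⟨ φlen-No11 no11 j ⟩
    φlen z (2 + j)  ≤⟨ φlen-mono z (s≤s j<m) ⟩
    φlen z c        ≡⟨ P≡ ⟨
    P               ∎)
    where open ≤-Reasoning
  z₂≈z₃ : Agree m z₂ z₃
  z₂≈z₃ = φω-cancel-prefix _ m gap
    (Agree-resp (λ i → sym (φz₂ i)) (λ i → sym (φz₃ i)) (Agree-drop P (Agree-drop P per)))

φω-FourMinusPowerPrefix : ∀ {z} → ¬ HasForbidden z → ∀ k → ¬ FourMinusPowerPrefix k (φω z)
φω-FourMinusPowerPrefix {z} nf zero per = nf (0 , inj₁ (z0 , z1))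
  where
  z0 : z 0 ≡ true
  z0 = not-injective (trans (sym (φω-1 z)) (sym (per 0 z<s)))
  z1 : z 1 ≡ true
  z1 = not-injective (trans (sym (φω-2 z z0)) (sym (trans (per 0 z<s) (per 1 (s≤s z<s)))))
φω-FourMinusPowerPrefix {z} nf (suc k) per
  with φω-false⇒block-start (suc (suc k) + 0) z (sym (per 0 z<s))
... | suc m , P≡ = nf (0 , inj₂ (m , φω-period-desubst (¬HasForbidden⇒No11 nf) m k
                                      (trans (sym (+-identityʳ _)) P≡) per))

φω-¬HasForbidden : ∀ {x} → ¬ HasForbidden x → ¬ HasForbidden (φω x)
φω-¬HasForbidden {x} nf (p , inj₁ eleven) = No11⇒¬ElevenPrefix (φω-No11 x) p eleven
φω-¬HasForbidden {x} nf (p , inj₂ (k , per)) with block-position p x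
... | inj₁ (n , refl) = φω-FourMinusPowerPrefix (nf ∘ HasForbidden-drop n {x}) k
  (FourMinusPowerPrefix-resp (φω-block n x) per)
... | inj₂ (n , refl , xn) = φω-FourMinusPowerPrefix (nf ∘ HasForbidden-drop n {x}) k
  (FourMinusPowerPrefix-untail refl second-letter (φω-No11 (drop n x)) (FourMinusPowerPrefix-resp shifted per))
  where
  second-letter : φω (drop n x) 1 ≡ true
  second-letter = trans (φω-1 (drop n x)) (trans (cong (not ∘ x) (+-identityʳ n)) (cong not xn))
  shifted : drop (suc (φlen x n)) (φω x) ≈ω tail (φω (drop n x))
  shifted i = trans (cong (φω x) (sym (+-suc (φlen x n) i))) (φω-block n x (suc i))

φω-preserves-FBω : ∀ x → FBω x → FBω (φω x)
φω-preserves-FBω x fb = ¬HasForbidden⇒FBω (φω x) (φω-¬HasForbidden λ h → HasForbidden⇒¬FBω x h fb)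

φω-reflects-FBω : ∀ y → FBω (φω y) → FBω y
φω-reflects-FBω y fb = ¬HasForbidden⇒FBω y λ h → HasForbidden⇒¬FBω (φω y) (φω-HasForbidden h) fb

FBω-resp : ∀ {x y} → x ≈ω y → FBω x → FBω y
FBω-resp {x} {y} x≈y fb n = subst FB (pref-cong n (≈ω⇒Agree x≈y)) (fb n)

FBω⇒No11 : ∀ {x} → FBω x → No11 x
FBω⇒No11 {x} fb = ¬HasForbidden⇒No11 λ h → HasForbidden⇒¬FBω x h fb

desubst : ωWord → ωWord
desubst l zero    = not (l 1)
desubst l (suc n) = desubst (drop (blockLength (not (l 1))) l) n

φω-desubst : ∀ {l} → l 0 ≡ false → No11 l → φω (desubst l) ≈ω l
φω-desubst l0 no11 zero = sym l0
φω-desubst {l} l0 no11 (suc i) = after (l 1) refl i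
  where
  after : ∀ c → l 1 ≡ c → ∀ i → φω-after (not c) (desubst (drop (blockLength (not c)) l)) i ≡ l (suc i)
  after true  l1 zero    = sym l1
  after true  l1 (suc i) = φω-desubst (no11 1 l1) (λ j → no11 (2 + j)) i
  after false l1 i       = φω-desubst l1 (λ j → no11 (suc j)) i

pref-φω-block : ∀ z → pref (φω z) (blockLength (z 0)) ≡ φ₁ (z 0)
pref-φω-block z = first-block (z 0) (tail z)
  where
  first-block : ∀ b t → false ∷ pref (φω-after b t) (pred (blockLength b)) ≡ φ₁ b
  first-block true  t = refl
  first-block false t = refl

φω-isφImage : ∀ m → IsφImage (φω m) m
φω-isφImage m zero    = refl
φω-isφImage m (suc n) = begin
  pref (φω m) (length (φ₁ (m 0) ++ w))        ≡⟨ cong (pref (φω m)) length-block ⟩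
  pref (φω m) (B + length w)                  ≡⟨ pref-+ B (length w) (φω m) ⟩
  pref (φω m) B ++ pref (drop B (φω m)) (length w)
    ≡⟨ cong₂ _++_ (pref-φω-block m) (pref-cong (length w) (≈ω⇒Agree (φω-step m))) ⟩
  φ₁ (m 0) ++ pref (φω (tail m)) (length w)   ≡⟨ cong (φ₁ (m 0) ++_) (φω-isφImage (tail m) n) ⟩
  φ₁ (m 0) ++ w                               ∎
  where
  open ≡-Reasoning
  w = φ (pref (tail m) n)
  B = blockLength (m 0)
  length-block : length (φ₁ (m 0) ++ w) ≡ B + length w
  length-block = trans (length-++ (φ₁ (m 0))) (cong (_+ length w) (length-φ₁ (m 0)))

<lex-respʳ : ∀ {x y y′} → y ≈ω y′ → x <lex y → x <lex y′
<lex-respʳ y≈y′ (n , pe , xn , yn) = n , trans pe (pref-cong n (≈ω⇒Agree y≈y′)) , xn , trans (sym (y≈y′ n)) yn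

<lex⇒¬≥lex : ∀ {x y} → x <lex y → ¬ y ≤lex x
<lex⇒¬≥lex (n , _ , xn , yn) (inj₁ y≈x) = true≢false (trans (sym yn) (trans (y≈x n) xn))
<lex⇒¬≥lex (n , pe , xn , yn) (inj₂ (n′ , pe′ , yn′ , xn′)) with <-cmp n n′
... | tri< n<n′ _ _ = true≢false (trans (sym yn) (trans (pref-agree n′ pe′ n n<n′) xn))
... | tri≈ _ refl _ = true≢false (trans (sym xn′) xn)
... | tri> _ _ n′<n = true≢false (trans (sym xn′) (trans (pref-agree n pe n′ n′<n) yn′))

≤lex-head : ∀ {x y} → x ≤lex y → y 0 ≡ false → x 0 ≡ false
≤lex-head (inj₁ x≈y)                   y0 = trans (x≈y 0) y0
≤lex-head (inj₂ (zero  , _  , x0 , _)) _  = x0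
≤lex-head (inj₂ (suc n , pe , _  , _)) y0 = trans (∷-injectiveˡ pe) y0

φω-antitone : ∀ {y z} → y <lex z → φω z <lex φω y
φω-antitone {y} {z} (n , pe , yn , zn) = suc (φlen z n) , pref-cong _ (φω-agree n z≈y) , φzN , φyN
  where
  z≈y : Agree n z y
  z≈y = Agree-sym (pref-agree n pe)
  φzN : φω z (suc (φlen z n)) ≡ false
  φzN = trans (φω-block-second n z) (cong not zn)
  φyN : φω y (suc (φlen z n)) ≡ true
  φyN = trans (cong (φω y ∘ suc) (φlen-cong n z≈y)) (trans (φω-block-second n y) (cong not yn))

lemma12 : (l m : ωWord) → IsLeastFB l → IsGreatestFB m → IsφImage l m
lemma12 l m (fb-l , least) (fb-m , greatest) n =
  trans (pref-cong _ (≈ω⇒Agree l≈φωm)) (φω-isφImage m n)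
  where
  l≤φωm : l ≤lex φω m
  l≤φωm = least (φω m) (φω-preserves-FBω m fb-m)
  y = desubst l
  φωy≈l : φω y ≈ω l
  φωy≈l = φω-desubst (≤lex-head l≤φωm refl) (FBω⇒No11 fb-l)
  fb-y : FBω y
  fb-y = φω-reflects-FBω y (FBω-resp (λ i → sym (φωy≈l i)) fb-l)
  l≈φωm : l ≈ω φω m
  l≈φωm with greatest y fb-y
  ... | inj₁ y≈m = λ i → trans (sym (φωy≈l i)) (φω-cong y≈m i)
  ... | inj₂ y<m = ⊥-elim (<lex⇒¬≥lex (<lex-respʳ φωy≈l (φω-antitone y<m)) l≤φωm)
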